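{- Let $N\ge k+1$ and $I_n=\langle 1,2,\dots,k,k+1,k,k-1,\dots,2\rangle^n$. Then $$\mathrm{LRU}^{P_N}_W(I_n)=\mathrm{LFD}^{P_N}_W(I_n)=2(n-1)+k+1.$$
   Context: Paging: a cache of size $k\ge1$, initially empty; on a request to a page not in cache (a fault) the page is brought in, evicting a page if the cache is full; $\mathrm{A}(I)$ is the number of faults of algorithm $\mathrm{A}$ on $I$. LRU evicts the least recently requested page in cache. LFD (Longest-Forward-Distance), an optimal offline algorithm, evicts the page in cache whose next request is latest (any page never requested again may be chosen). An access graph is an undirected graph whose vertices are the pages; a sequence respects it if any two consecutive requests are to the same page or to adjacent vertices. $P_N$ is the path graph with vertices $1,\dots,N$ and edges $\{i,i+1\}$. For an algorithm $\mathrm{A}$ and access graph $G$, $\mathrm{A}^G_W(I)=\max_\sigma \mathrm{A}(\sigma(I))$ over all permutations $\sigma$ of the requests of $I$ such that $\sigma(I)$ respects $G$. -}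

module Defs where

open import Data.Nat using (ℕ; zero; suc; _+_; _*_; _∸_; _≤_; _<ᵇ_; _≡ᵇ_)
open import Data.Bool using (Bool; true; false; if_then_else_; _∨_)
open import Data.List using (List; []; _∷_; _++_; length; map; upTo; concat; replicate; filter)
open import Data.List.Relation.Unary.All using (All)
open import Data.List.Relation.Binary.Permutation.Propositional using (_↭_)
open import Data.Product using (_×_; ∃-syntax)
open import Data.Sum using (_⊎_)
open import Relation.Binary.PropositionalEquality using (_≡_)

member : ℕ → List ℕ → Bool
member p []       = false
member p (q ∷ qs) = (p ≡ᵇ q) ∨ member p qs

-- remove every occurrence of p (a cache never holds duplicates)
remove : ℕ → List ℕ → List ℕ
remove p []       = []
remove p (q ∷ qs) = if p ≡ᵇ q then remove p qs else q ∷ remove p qs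

dropLast : List ℕ → List ℕ
dropLast []           = []
dropLast (x ∷ [])     = []
dropLast (x ∷ y ∷ xs) = x ∷ dropLast (y ∷ xs)

-- LRU.  The cache is kept ordered by recency: most recently requested
-- page first, least recently requested page last.
-- lruRun k cache requests = number of faults.

lruRun : ℕ → List ℕ → List ℕ → ℕ
lruRun k cache []       = 0
lruRun k cache (p ∷ ps) with member p cache
... | true  = lruRun k (p ∷ remove p cache) ps
... | false = suc (lruRun k (p ∷ (if length cache <ᵇ k then cache else dropLast cache)) ps)

LRU : ℕ → List ℕ → ℕ
LRU k I = lruRun k [] I

-- LFD.  dist p rest = position of the next request of p in rest, or
-- length rest if p is never requested again (later than any request).

dist : ℕ → List ℕ → ℕ
dist p []       = 0
dist p (q ∷ qs) = if p ≡ᵇ q then 0 else suc (dist p qs)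

-- argmax of f, ties broken in favour of the earlier element
pickMax : (ℕ → ℕ) → ℕ → List ℕ → ℕ
pickMax f b []       = b
pickMax f b (x ∷ xs) = if f b <ᵇ f x then pickMax f x xs else pickMax f b xs

victim : List ℕ → List ℕ → ℕ
victim rest []       = 0
victim rest (c ∷ cs) = pickMax (λ q → dist q rest) c cs

lfdRun : ℕ → List ℕ → List ℕ → ℕ
lfdRun k cache []       = 0
lfdRun k cache (p ∷ ps) with member p cache
... | true  = lfdRun k cache ps
... | false = suc (lfdRun k (p ∷ (if length cache <ᵇ k then cache else remove (victim ps cache) cache)) ps)

LFD : ℕ → List ℕ → ℕ
LFD k I = lfdRun k [] I

IsVertex : ℕ → ℕ → Set
IsVertex N p = 1 ≤ p × p ≤ N

PathEdge : ℕ → ℕ → ℕ → Set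
PathEdge N a b = (1 ≤ a × suc a ≡ b × b ≤ N) ⊎ (1 ≤ b × suc b ≡ a × a ≤ N)

Consecutive : ℕ → List ℕ → Set
Consecutive N []           = Data.Unit.⊤ where import Data.Unit
Consecutive N (a ∷ [])     = Data.Unit.⊤ where import Data.Unit
Consecutive N (a ∷ b ∷ xs) = (a ≡ b ⊎ PathEdge N a b) × Consecutive N (b ∷ xs)

RespectsPath : ℕ → List ℕ → Set
RespectsPath N σ = All (IsVertex N) σ × Consecutive N σ

WorstIs : (List ℕ → ℕ) → ℕ → List ℕ → ℕ → Set
WorstIs A N I v =
  (∃[ σI ] (σI ↭ I × RespectsPath N σI × A σI ≡ v)) ×
  (∀ σI → σI ↭ I → RespectsPath N σI → A σI ≤ v)

down : ℕ → List ℕ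
down zero          = []
down (suc zero)    = []
down (suc (suc m)) = suc (suc m) ∷ down (suc m)

block : ℕ → List ℕ
block k = map suc (upTo (suc k)) ++ down k

Iseq : ℕ → ℕ → List ℕ
Iseq k n = concat (replicate n (block k))

module Submission where

open import Defs
open import Data.Nat using (ℕ; zero; suc; _+_; _*_; _∸_; _≤_; _<_; _<ᵇ_; _≡ᵇ_; z≤n; s≤s)
open import Data.Nat.Properties
open import Data.Nat.ListAction using (sum)
open import Data.Nat.ListAction.Properties using (sum-++; sum-↭)
open import Data.Nat.Tactic.RingSolver using (solve-∀)
open import Data.Bool using (true; false; if_then_else_; _∨_; T)
open import Data.Bool.Properties using (∨-zeroʳ)
open import Data.List using (List; []; _∷_; _++_; length; map; upTo; applyUpTo)
open import Data.List.Properties using (map-++; map-applyUpTo; ++-assoc)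
open import Data.List.Relation.Unary.All using (All; []; _∷_)
open import Data.List.Relation.Binary.Permutation.Propositional using (_↭_)
import Data.List.Relation.Binary.Permutation.Propositional as ↭
import Data.List.Relation.Binary.Permutation.Propositional.Properties as ↭ₚ
open import Data.Unit using (⊤; tt)
open import Data.Empty using (⊥-elim)
open import Data.Sum using (_⊎_; inj₁; inj₂; [_,_]′; map₁)
open import Data.Product using (_×_; _,_; proj₁; proj₂; Σ; map₂)
open import Function using (case_of_)
open import Relation.Binary.PropositionalEquality
open import Relation.Binary.Definitions using (Tri; tri<; tri≈; tri>)
open import Relation.Nullary using (¬_; yes; no; Dec)

-- Upper bound (potential argument).  For a cache c and remaining requests
-- s let `potential c s` count the middle pages 2, …, k that are requested
-- in s but not cached, plus the requests to the endpoints 1 and k+1 in s.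
-- A hit does not increase it, and a fault decreases it provided no middle
-- page that is requested again gets evicted.  On a walk this is what LRU
-- and LFD do: a full cache missing p holds the endpoint on the far side of
-- each cached middle page m, and the walk passes m between that endpoint
-- and p, so m is neither least recently nor latest requested
-- (`lru-keeps-middle`, `lfd-keeps-middle`).  Initially the potential is at
-- most (k-1) + 2n.
--
-- Lower bound (covering windows), valid for every demand-paging algorithm:
-- if the cache and a window of requests together cover all k+1 pages, the
-- window contains a fault.  On I_n itself the first block costs k+1 cold
-- faults and each later block splits into two such windows.

T-true : ∀ {b} → T b → b ≡ true
T-true {true} _ = refl

≡ᵇ-true : ∀ {x y} → (x ≡ᵇ y) ≡ true → x ≡ y
≡ᵇ-true {x} {y} e = ≡ᵇ⇒≡ x y (subst T (sym e) tt)

≡ᵇ-refl : ∀ x → (x ≡ᵇ x) ≡ true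
≡ᵇ-refl x = T-true (≡⇒≡ᵇ x x refl)

≡ᵇ-false : ∀ {x y} → x ≢ y → (x ≡ᵇ y) ≡ false
≡ᵇ-false {x} {y} x≢y with x ≡ᵇ y in e
... | true  = ⊥-elim (x≢y (≡ᵇ-true e))
... | false = refl

≡ᵇ-false⇒≢ : ∀ {x y} → (x ≡ᵇ y) ≡ false → x ≢ y
≡ᵇ-false⇒≢ {x} e refl with trans (sym (≡ᵇ-refl x)) e
... | ()

<ᵇ-true : ∀ {m n} → (m <ᵇ n) ≡ true → m < n
<ᵇ-true {m} {n} e = <ᵇ⇒< m n (subst T (sym e) tt)

<ᵇ-false : ∀ {m n} → (m <ᵇ n) ≡ false → n ≤ m
<ᵇ-false e = ≮⇒≥ (λ m<n → case trans (sym (T-true (<⇒<ᵇ m<n))) e of λ ())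

infix 4 _∈ᵇ_ _∉ᵇ_ _⊆ᵇ_

_∈ᵇ_ : ℕ → List ℕ → Set
x ∈ᵇ xs = member x xs ≡ true

_∉ᵇ_ : ℕ → List ℕ → Set
x ∉ᵇ xs = member x xs ≡ false

_⊆ᵇ_ : List ℕ → List ℕ → Set
xs ⊆ᵇ ys = ∀ x → x ∈ᵇ xs → x ∈ᵇ ys

∈ᵇ-dec : ∀ x xs → x ∈ᵇ xs ⊎ x ∉ᵇ xs
∈ᵇ-dec x xs with member x xs
... | true  = inj₁ refl
... | false = inj₂ refl

∉ᵇ⇒¬∈ᵇ : ∀ x xs → x ∉ᵇ xs → ¬ x ∈ᵇ xs
∉ᵇ⇒¬∈ᵇ x xs x∉ x∈ with trans (sym x∈) x∉
... | ()

∈ᵇ-here : ∀ x xs → x ∈ᵇ x ∷ xs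
∈ᵇ-here x xs rewrite ≡ᵇ-refl x = refl

∈ᵇ-there : ∀ x y ys → x ∈ᵇ ys → x ∈ᵇ y ∷ ys
∈ᵇ-there x y ys x∈ rewrite x∈ = ∨-zeroʳ (x ≡ᵇ y)

∈ᵇ-≡ : ∀ x y ys → x ≡ y → x ∈ᵇ y ∷ ys
∈ᵇ-≡ x .x ys refl = ∈ᵇ-here x ys

∈ᵇ-∷⁻ : ∀ x y ys → x ∈ᵇ y ∷ ys → x ≡ y ⊎ x ∈ᵇ ys
∈ᵇ-∷⁻ x y ys x∈ with x ≡ᵇ y in e
... | true  = inj₁ (≡ᵇ-true e)
... | false = inj₂ x∈

∉ᵇ-∷⁻ : ∀ x y ys → x ∉ᵇ y ∷ ys → x ≢ y × x ∉ᵇ ys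
∉ᵇ-∷⁻ x y ys x∉ with x ≡ᵇ y in e
... | false = ≡ᵇ-false⇒≢ e , x∉

∉ᵇ-⊆ : ∀ x xs ys → ys ⊆ᵇ xs → x ∉ᵇ xs → x ∉ᵇ ys
∉ᵇ-⊆ x xs ys ys⊆xs x∉xs with ∈ᵇ-dec x ys
... | inj₁ x∈ys = ⊥-elim (∉ᵇ⇒¬∈ᵇ x xs x∉xs (ys⊆xs x x∈ys))
... | inj₂ x∉ys = x∉ys

∷-⊆ᵇ : ∀ p xs ys → xs ⊆ᵇ ys → p ∷ xs ⊆ᵇ p ∷ ys
∷-⊆ᵇ p xs ys xs⊆ys x x∈ = [ ∈ᵇ-≡ x p ys , (λ x∈xs → ∈ᵇ-there x p ys (xs⊆ys x x∈xs)) ]′ (∈ᵇ-∷⁻ x p xs x∈)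

∈ᵇ-++⁺ˡ : ∀ x xs ys → x ∈ᵇ xs → x ∈ᵇ xs ++ ys
∈ᵇ-++⁺ˡ x (z ∷ xs) ys x∈ with ∈ᵇ-∷⁻ x z xs x∈
... | inj₁ refl = ∈ᵇ-here x (xs ++ ys)
... | inj₂ x∈xs = ∈ᵇ-there x z (xs ++ ys) (∈ᵇ-++⁺ˡ x xs ys x∈xs)

∈ᵇ-++⁺ʳ : ∀ x xs ys → x ∈ᵇ ys → x ∈ᵇ xs ++ ys
∈ᵇ-++⁺ʳ x []       ys x∈ = x∈
∈ᵇ-++⁺ʳ x (z ∷ xs) ys x∈ = ∈ᵇ-there x z (xs ++ ys) (∈ᵇ-++⁺ʳ x xs ys x∈)

∈ᵇ-++⁻ : ∀ x xs ys → x ∈ᵇ xs ++ ys → x ∈ᵇ xs ⊎ x ∈ᵇ ys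
∈ᵇ-++⁻ x []       ys x∈ = inj₂ x∈
∈ᵇ-++⁻ x (z ∷ xs) ys x∈ with ∈ᵇ-∷⁻ x z (xs ++ ys) x∈
... | inj₁ refl = inj₁ (∈ᵇ-here x xs)
... | inj₂ x∈′  = map₁ (∈ᵇ-there x z xs) (∈ᵇ-++⁻ x xs ys x∈′)

∨-swap : ∀ a b c → a ∨ (b ∨ c) ≡ b ∨ (a ∨ c)
∨-swap true  true  c = refl
∨-swap true  false c = refl
∨-swap false true  c = refl
∨-swap false false c = refl

All-∈ᵇ : ∀ {P : ℕ → Set} xs → (∀ x → x ∈ᵇ xs → P x) → All P xs
All-∈ᵇ []       _   = []
All-∈ᵇ (x ∷ xs) all = all x (∈ᵇ-here x xs) ∷ All-∈ᵇ xs (λ y y∈ → all y (∈ᵇ-there y x xs y∈))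

member-↭ : ∀ x {xs ys} → xs ↭ ys → member x xs ≡ member x ys
member-↭ x ↭.refl         = refl
member-↭ x (↭.prep y p)   = cong ((x ≡ᵇ y) ∨_) (member-↭ x p)
member-↭ x (↭.swap {xs} {ys} y z p) = begin
  (x ≡ᵇ y) ∨ ((x ≡ᵇ z) ∨ member x xs)  ≡⟨ cong (λ b → (x ≡ᵇ y) ∨ ((x ≡ᵇ z) ∨ b)) (member-↭ x p) ⟩
  (x ≡ᵇ y) ∨ ((x ≡ᵇ z) ∨ member x ys)  ≡⟨ ∨-swap (x ≡ᵇ y) (x ≡ᵇ z) (member x ys) ⟩
  (x ≡ᵇ z) ∨ ((x ≡ᵇ y) ∨ member x ys)  ∎
  where open ≡-Reasoning
member-↭ x (↭.trans p q)  = trans (member-↭ x p) (member-↭ x q)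

member-remove : ∀ x p c → x ≢ p → member x (remove p c) ≡ member x c
member-remove x p []       x≢p = refl
member-remove x p (q ∷ qs) x≢p with p ≡ᵇ q in e
... | true with refl ← ≡ᵇ-true {p} {q} e rewrite ≡ᵇ-false x≢p = member-remove x p qs x≢p
... | false = cong ((x ≡ᵇ q) ∨_) (member-remove x p qs x≢p)

∉ᵇ-remove : ∀ p c → p ∉ᵇ remove p c
∉ᵇ-remove p []       = refl
∉ᵇ-remove p (q ∷ qs) with p ≡ᵇ q in e
... | true  = ∉ᵇ-remove p qs
... | false rewrite e = ∉ᵇ-remove p qs

remove-⊆ᵇ : ∀ p c → remove p c ⊆ᵇ c
remove-⊆ᵇ p c x x∈ with x ≟ p
... | yes refl = ⊥-elim (∉ᵇ⇒¬∈ᵇ x (remove x c) (∉ᵇ-remove x c) x∈)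
... | no x≢p   = trans (sym (member-remove x p c x≢p)) x∈

⊆ᵇ-to-front : ∀ p c → c ⊆ᵇ p ∷ remove p c
⊆ᵇ-to-front p c x x∈ with x ≟ p
... | yes x≡p = ∈ᵇ-≡ x p (remove p c) x≡p
... | no x≢p  = ∈ᵇ-there x p (remove p c) (trans (member-remove x p c x≢p) x∈)

length-remove-≤ : ∀ p c → length (remove p c) ≤ length c
length-remove-≤ p []       = z≤n
length-remove-≤ p (q ∷ qs) with p ≡ᵇ q
... | true  = m≤n⇒m≤1+n (length-remove-≤ p qs)
... | false = s≤s (length-remove-≤ p qs)

length-remove-< : ∀ p c → p ∈ᵇ c → length (remove p c) < length c
length-remove-< p (q ∷ qs) p∈ with p ≡ᵇ q
... | true  = s≤s (length-remove-≤ p qs)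
... | false = s≤s (length-remove-< p qs p∈)

dropLast-⊆ᵇ : ∀ c → dropLast c ⊆ᵇ c
dropLast-⊆ᵇ (a ∷ b ∷ c) x x∈ =
  [ ∈ᵇ-≡ x a (b ∷ c) , (λ x∈′ → ∈ᵇ-there x a (b ∷ c) (dropLast-⊆ᵇ (b ∷ c) x x∈′)) ]′
  (∈ᵇ-∷⁻ x a (dropLast (b ∷ c)) x∈)

length-dropLast : ∀ a c → suc (length (dropLast (a ∷ c))) ≡ length (a ∷ c)
length-dropLast a []      = refl
length-dropLast a (b ∷ c) = cong suc (length-dropLast b c)

Distinct : List ℕ → Set
Distinct []       = ⊤
Distinct (x ∷ xs) = x ∉ᵇ xs × Distinct xs

Distinct-remove : ∀ p c → Distinct c → Distinct (remove p c)
Distinct-remove p []       _          = tt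
Distinct-remove p (q ∷ qs) (q∉ , dqs) with p ≡ᵇ q
... | true  = Distinct-remove p qs dqs
... | false = ∉ᵇ-⊆ q qs (remove p qs) (remove-⊆ᵇ p qs) q∉ , Distinct-remove p qs dqs

Distinct-dropLast : ∀ c → Distinct c → Distinct (dropLast c)
Distinct-dropLast []          _          = tt
Distinct-dropLast (a ∷ [])    _          = tt
Distinct-dropLast (a ∷ b ∷ c) (a∉ , dbc) =
  ∉ᵇ-⊆ a (b ∷ c) (dropLast (b ∷ c)) (dropLast-⊆ᵇ (b ∷ c)) a∉ , Distinct-dropLast (b ∷ c) dbc

distinct-length-≤ : ∀ xs ys → Distinct xs → xs ⊆ᵇ ys → length xs ≤ length ys
distinct-length-≤ []       ys _          _  = z≤n
distinct-length-≤ (x ∷ xs) ys (x∉ , dxs) ⊆ys = begin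
  suc (length xs)              ≤⟨ s≤s (distinct-length-≤ xs (remove x ys) dxs xs⊆) ⟩
  suc (length (remove x ys))   ≤⟨ length-remove-< x ys (⊆ys x (∈ᵇ-here x xs)) ⟩
  length ys                    ∎
  where
  open ≤-Reasoning
  xs⊆ : xs ⊆ᵇ remove x ys
  xs⊆ y y∈ with y ≟ x
  ... | yes refl = ⊥-elim (∉ᵇ⇒¬∈ᵇ y xs x∉ y∈)
  ... | no y≢x   = trans (member-remove y x ys y≢x) (⊆ys y (∈ᵇ-there y x xs y∈))

Sorted : (ℕ → ℕ) → List ℕ → Set
Sorted f []       = ⊤
Sorted f (x ∷ xs) = (∀ y → y ∈ᵇ xs → f x < f y) × Sorted f xs

Sorted-remove : ∀ f p c → Sorted f c → Sorted f (remove p c)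
Sorted-remove f p []       _         = tt
Sorted-remove f p (q ∷ qs) (q< , sqs) with p ≡ᵇ q
... | true  = Sorted-remove f p qs sqs
... | false = (λ y y∈ → q< y (remove-⊆ᵇ p qs y y∈)) , Sorted-remove f p qs sqs

Sorted-dropLast : ∀ f c → Sorted f c → Sorted f (dropLast c)
Sorted-dropLast f []          _          = tt
Sorted-dropLast f (a ∷ [])    _          = tt
Sorted-dropLast f (a ∷ b ∷ c) (a< , sbc) =
  (λ y y∈ → a< y (dropLast-⊆ᵇ (b ∷ c) y y∈)) , Sorted-dropLast f (b ∷ c) sbc

Sorted-shift : ∀ f g c → (∀ x → x ∈ᵇ c → g x ≡ suc (f x)) → Sorted f c → Sorted g c
Sorted-shift f g []       _     _         = tt
Sorted-shift f g (x ∷ xs) g≡f+1 (x< , sxs) =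
  (λ y y∈ → subst₂ _<_ (sym (g≡f+1 x (∈ᵇ-here x xs))) (sym (g≡f+1 y (∈ᵇ-there y x xs y∈))) (s≤s (x< y y∈))) ,
  Sorted-shift f g xs (λ y y∈ → g≡f+1 y (∈ᵇ-there y x xs y∈)) sxs

dropLast-max : ∀ f c m → Sorted f c → m ∈ᵇ c → m ∉ᵇ dropLast c → ∀ y → y ∈ᵇ c → f y ≤ f m
dropLast-max f []       m _ () _ y y∈
dropLast-max f (a ∷ []) m _ m∈ _ y y∈ =
  ≤-reflexive (cong f (trans (onlyA y y∈) (sym (onlyA m m∈))))
  where
  onlyA : ∀ x → x ∈ᵇ a ∷ [] → x ≡ a
  onlyA x x∈ = [ (λ x≡a → x≡a) , (λ ()) ]′ (∈ᵇ-∷⁻ x a [] x∈)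
dropLast-max f (a ∷ b ∷ c) m (a< , sbc) m∈ m∉ y y∈ =
  [ (λ m≡a → ⊥-elim (proj₁ (∉ᵇ-∷⁻ m a (dropLast (b ∷ c)) m∉) m≡a))
  , (λ m∈′ → [ (λ y≡a → subst (λ z → f z ≤ f m) (sym y≡a) (<⇒≤ (a< m m∈′)))
             , dropLast-max f (b ∷ c) m sbc m∈′ (proj₂ (∉ᵇ-∷⁻ m a (dropLast (b ∷ c)) m∉)) y
             ]′ (∈ᵇ-∷⁻ y a (b ∷ c) y∈))
  ]′ (∈ᵇ-∷⁻ m a (b ∷ c) m∈)

pickMax-≥-start : ∀ (f : ℕ → ℕ) b xs → f b ≤ f (pickMax f b xs)
pickMax-≥-start f b []       = ≤-refl
pickMax-≥-start f b (x ∷ xs) with f b <ᵇ f x in e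
... | true  = ≤-trans (<⇒≤ (<ᵇ-true e)) (pickMax-≥-start f x xs)
... | false = pickMax-≥-start f b xs

pickMax-max : ∀ (f : ℕ → ℕ) b xs y → y ∈ᵇ b ∷ xs → f y ≤ f (pickMax f b xs)
pickMax-max f b []       y y∈ with ∈ᵇ-∷⁻ y b [] y∈
... | inj₁ refl = ≤-refl
pickMax-max f b (x ∷ xs) y y∈ with f b <ᵇ f x in e | ∈ᵇ-∷⁻ y b (x ∷ xs) y∈
... | true  | inj₁ refl = ≤-trans (<⇒≤ (<ᵇ-true e)) (pickMax-≥-start f x xs)
... | true  | inj₂ y∈′  = pickMax-max f x xs y y∈′
... | false | inj₁ refl = pickMax-≥-start f y xs
... | false | inj₂ y∈′ with ∈ᵇ-∷⁻ y x xs y∈′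
...   | inj₁ refl = ≤-trans (<ᵇ-false e) (pickMax-≥-start f b xs)
...   | inj₂ y∈″  = pickMax-max f b xs y (∈ᵇ-there y b xs y∈″)

pickMax-∈ᵇ : ∀ (f : ℕ → ℕ) b xs → pickMax f b xs ∈ᵇ b ∷ xs
pickMax-∈ᵇ f b []       = ∈ᵇ-here b []
pickMax-∈ᵇ f b (x ∷ xs) with f b <ᵇ f x
... | true  = ∈ᵇ-there _ b (x ∷ xs) (pickMax-∈ᵇ f x xs)
... | false with ∈ᵇ-∷⁻ (pickMax f b xs) b xs (pickMax-∈ᵇ f b xs)
...   | inj₁ e   = ∈ᵇ-≡ _ b (x ∷ xs) e
...   | inj₂ p∈  = ∈ᵇ-there _ b (x ∷ xs) (∈ᵇ-there _ x xs p∈)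

victim-max : ∀ rest c y → y ∈ᵇ c → dist y rest ≤ dist (victim rest c) rest
victim-max rest (c ∷ cs) y y∈ = pickMax-max (λ q → dist q rest) c cs y y∈

victim-∈ᵇ : ∀ rest a cs → victim rest (a ∷ cs) ∈ᵇ a ∷ cs
victim-∈ᵇ rest a cs = pickMax-∈ᵇ (λ q → dist q rest) a cs

Near : ℕ → ℕ → Set
Near x y = x ≤ suc y × y ≤ suc x

Walk : List ℕ → Set
Walk []           = ⊤
Walk (x ∷ [])     = ⊤
Walk (x ∷ y ∷ xs) = Near x y × Walk (y ∷ xs)

walk-tail : ∀ p ps → Walk (p ∷ ps) → Walk ps
walk-tail p []       _       = tt
walk-tail p (q ∷ ps) (_ , w) = w

Between : ℕ → ℕ → ℕ → Set
Between u m q = (u < m × m ≤ q) ⊎ (q ≤ m × m < u)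

Between⇒≢ˡ : ∀ u m q → Between u m q → u ≢ m
Between⇒≢ˡ u m q (inj₁ (u<m , _)) u≡m = <-irrefl u≡m u<m
Between⇒≢ˡ u m q (inj₂ (_ , m<u)) u≡m = <-irrefl (sym u≡m) m<u

Between⇒≢ʳ : ∀ u m q → Between u m q → u ≢ q
Between⇒≢ʳ u m q (inj₁ (u<m , m≤q)) refl = <-irrefl refl (<-≤-trans u<m m≤q)
Between⇒≢ʳ u m q (inj₂ (q≤m , m<u)) refl = <-irrefl refl (≤-<-trans q≤m m<u)

StrictlyBetween : ℕ → ℕ → ℕ → Set
StrictlyBetween u m p = (u < m × m < p) ⊎ (p < m × m < u)

StrictlyBetween⇒≢ : ∀ u m p → StrictlyBetween u m p → u ≢ p
StrictlyBetween⇒≢ u m p (inj₁ (u<m , m<p)) refl = <-asym u<m m<p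
StrictlyBetween⇒≢ u m p (inj₂ (p<m , m<u)) refl = <-asym p<m m<u

StrictlyBetween⇒Between : ∀ u m p q → Near p q → StrictlyBetween u m p → Between u m q
StrictlyBetween⇒Between u m p q (p≤q+1 , _) (inj₁ (u<m , m<p)) = inj₁ (u<m , ≤-pred (≤-trans m<p p≤q+1))
StrictlyBetween⇒Between u m p q (_ , q≤p+1) (inj₂ (p<m , m<u)) = inj₂ (≤-trans q≤p+1 p<m , m<u)

-- A walk cannot jump over a vertex: a walk from q that visits m visits it
-- strictly before it visits u (if ever) whenever m lies between u and q.
walk-visits-between-first : ∀ q w u m → Walk (q ∷ w) → m ∈ᵇ q ∷ w → Between u m q →
                            dist m (q ∷ w) < dist u (q ∷ w)
walk-visits-between-first q w u m wk m∈ btw with m ≟ q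
... | yes refl rewrite ≡ᵇ-refl m | ≡ᵇ-false (Between⇒≢ˡ u m m btw) = s≤s z≤n
... | no m≢q with ∈ᵇ-∷⁻ m q w m∈
...   | inj₁ m≡q = ⊥-elim (m≢q m≡q)
...   | inj₂ m∈w rewrite ≡ᵇ-false m≢q | ≡ᵇ-false (Between⇒≢ʳ u m q btw) = s≤s (later w wk m∈w)
  where
  later : ∀ w → Walk (q ∷ w) → m ∈ᵇ w → dist m w < dist u w
  later (y ∷ w′) ((q≤y+1 , y≤q+1) , wk′) m∈′ = walk-visits-between-first y w′ u m wk′ m∈′ (step btw)
    where
    step : Between u m q → Between u m y
    step (inj₁ (u<m , m≤q)) = inj₁ (u<m , ≤-pred (≤-trans (≤∧≢⇒< m≤q m≢q) q≤y+1))
    step (inj₂ (q≤m , m<u)) = inj₂ (≤-trans y≤q+1 (≤∧≢⇒< q≤m (λ q≡m → m≢q (sym q≡m))) , m<u)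

sum-map-mono : ∀ (f g : ℕ → ℕ) L → (∀ m → m ∈ᵇ L → f m ≤ g m) → sum (map f L) ≤ sum (map g L)
sum-map-mono f g []      _   = z≤n
sum-map-mono f g (x ∷ L) f≤g =
  +-mono-≤ (f≤g x (∈ᵇ-here x L)) (sum-map-mono f g L (λ m m∈ → f≤g m (∈ᵇ-there m x L m∈)))

sum-map-strict : ∀ (f g : ℕ → ℕ) L p → (∀ m → m ∈ᵇ L → f m ≤ g m) → p ∈ᵇ L → f p < g p →
                 sum (map f L) < sum (map g L)
sum-map-strict f g (x ∷ L) p f≤g p∈ fp<gp with ∈ᵇ-∷⁻ p x L p∈
... | inj₁ refl = +-mono-<-≤ fp<gp (sum-map-mono f g L (λ m m∈ → f≤g m (∈ᵇ-there m x L m∈)))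
... | inj₂ p∈L  = +-mono-≤-< (f≤g x (∈ᵇ-here x L)) (sum-map-strict f g L p (λ m m∈ → f≤g m (∈ᵇ-there m x L m∈)) p∈L fp<gp)

sum-map-≤-length : ∀ (f : ℕ → ℕ) L → (∀ m → f m ≤ 1) → sum (map f L) ≤ length L
sum-map-≤-length f []      _    = z≤n
sum-map-≤-length f (x ∷ L) f≤1 = +-mono-≤ (f≤1 x) (sum-map-≤-length f L f≤1)

occurrences : ℕ → List ℕ → ℕ
occurrences t s = sum (map (λ x → if x ≡ᵇ t then 1 else 0) s)

occurrences-↭ : ∀ t {xs ys} → xs ↭ ys → occurrences t xs ≡ occurrences t ys
occurrences-↭ t p = sum-↭ (↭ₚ.map⁺ _ p)

occurrences-++ : ∀ t xs ys → occurrences t (xs ++ ys) ≡ occurrences t xs + occurrences t ys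
occurrences-++ t xs ys = trans (cong sum (map-++ _ xs ys)) (sum-++ (map _ xs) (map _ ys))

occurrences-∷ : ∀ t p s → occurrences t s ≤ occurrences t (p ∷ s)
occurrences-∷ t p s = m≤n+m (occurrences t s) _

occurrences-absent : ∀ t xs → (∀ x → x ∈ᵇ xs → x ≢ t) → occurrences t xs ≡ 0
occurrences-absent t []       _   = refl
occurrences-absent t (x ∷ xs) x≢t rewrite ≡ᵇ-false (x≢t x (∈ᵇ-here x xs)) =
  occurrences-absent t xs (λ y y∈ → x≢t y (∈ᵇ-there y x xs y∈))

-- From here on the cache size k is fixed; the pages are 1, …, k+1, the
-- endpoints of the path are 1 and k+1, and 2, …, k are the middle pages.
module Paging (k : ℕ) where

  Page : ℕ → Set
  Page x = 1 ≤ x × x ≤ suc k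

  WellFormed : List ℕ → Set
  WellFormed c = Distinct c × (∀ x → x ∈ᵇ c → Page x)

  pages : ℕ → List ℕ
  pages zero    = []
  pages (suc n) = suc n ∷ pages n

  length-pages : ∀ n → length (pages n) ≡ n
  length-pages zero    = refl
  length-pages (suc n) = cong suc (length-pages n)

  ∈ᵇ-pages : ∀ n x → 1 ≤ x → x ≤ n → x ∈ᵇ pages n
  ∈ᵇ-pages zero    zero    ()  _
  ∈ᵇ-pages zero    (suc x) _   ()
  ∈ᵇ-pages (suc n) x 1≤x x≤n with x ≟ suc n
  ... | yes x≡n = ∈ᵇ-≡ x (suc n) (pages n) x≡n
  ... | no x≢n  = ∈ᵇ-there x (suc n) (pages n) (∈ᵇ-pages n x 1≤x (≤-pred (≤∧≢⇒< x≤n x≢n)))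

  pages-bounds : ∀ n x → x ∈ᵇ pages n → x ≤ n
  pages-bounds (suc n) x x∈ with ∈ᵇ-∷⁻ x (suc n) (pages n) x∈
  ... | inj₁ refl = ≤-refl
  ... | inj₂ x∈′  = m≤n⇒m≤1+n (pages-bounds n x x∈′)

  Distinct-pages : ∀ n → Distinct (pages n)
  Distinct-pages zero    = tt
  Distinct-pages (suc n) with ∈ᵇ-dec (suc n) (pages n)
  ... | inj₁ n+1∈ = ⊥-elim (1+n≰n (pages-bounds n (suc n) n+1∈))
  ... | inj₂ n+1∉ = n+1∉ , Distinct-pages n

  allPaging-Page : ∀ x → x ∈ᵇ pages (suc k) → Page x
  allPaging-Page x x∈ = lower x∈ , pages-bounds (suc k) x x∈
    where
    lower : ∀ {n} → x ∈ᵇ pages n → 1 ≤ x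
    lower {suc n} x∈′ = [ (λ { refl → s≤s z≤n }) , lower {n} ]′ (∈ᵇ-∷⁻ x (suc n) (pages n) x∈′)

  no-cache-holds-all-pages : ∀ c → length c ≤ k → ¬ (∀ y → Page y → y ∈ᵇ c)
  no-cache-holds-all-pages c c≤k all∈ = 1+n≰n (≤-trans k+1≤c c≤k)
    where
    k+1≤c : suc k ≤ length c
    k+1≤c = subst (_≤ length c) (length-pages (suc k))
              (distinct-length-≤ (pages (suc k)) c (Distinct-pages (suc k)) (λ x x∈ → all∈ x (allPaging-Page x x∈)))

  full-cache-holds-others : ∀ c p u → WellFormed c → k ≤ length c → p ∉ᵇ c → Page p → Page u → u ≢ p → u ∈ᵇ c
  full-cache-holds-others c p u (dc , c-pages) full p∉c (1≤p , p≤k+1) (1≤u , u≤k+1) u≢p with ∈ᵇ-dec u c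
  ... | inj₁ u∈c = u∈c
  ... | inj₂ u∉c = ⊥-elim (1+n≰n (≤-trans c<k full))
    where
    open ≤-Reasoning
    others : List ℕ
    others = remove p (remove u (pages (suc k)))
    c⊆others : c ⊆ᵇ others
    c⊆others x x∈ with x ≟ p | x ≟ u
    ... | yes refl | _        = ⊥-elim (∉ᵇ⇒¬∈ᵇ x c p∉c x∈)
    ... | no _     | yes refl = ⊥-elim (∉ᵇ⇒¬∈ᵇ x c u∉c x∈)
    ... | no x≢p   | no x≢u   =
      trans (member-remove x p (remove u (pages (suc k))) x≢p) (trans (member-remove x u (pages (suc k)) x≢u)
        (∈ᵇ-pages (suc k) x (proj₁ (c-pages x x∈)) (proj₂ (c-pages x x∈))))
    p∈ : p ∈ᵇ remove u (pages (suc k))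
    p∈ = trans (member-remove p u (pages (suc k)) (λ p≡u → u≢p (sym p≡u))) (∈ᵇ-pages (suc k) p 1≤p p≤k+1)
    c<k : length c < k
    c<k = ≤-pred (begin-strict
      suc (length c)                            ≤⟨ s≤s (distinct-length-≤ c others dc c⊆others) ⟩
      suc (length others)                       ≤⟨ length-remove-< p (remove u (pages (suc k))) p∈ ⟩
      length (remove u (pages (suc k)))         <⟨ length-remove-< u (pages (suc k)) (∈ᵇ-pages (suc k) u 1≤u u≤k+1) ⟩
      length (pages (suc k))                    ≡⟨ length-pages (suc k) ⟩
      suc k                                     ∎)

  -- In a full cache that misses the requested page p, every cached middle page
  -- m is shielded: the cache also holds the endpoint u on the far side of m
  -- from p.  This is what keeps LRU and LFD from evicting useful middle pages.
  shielding-endpoint : ∀ c p m → WellFormed c → k ≤ length c → p ∉ᵇ c → Page p →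
                       2 ≤ m → m ≤ k → m ∈ᵇ c → Σ ℕ λ u → u ∈ᵇ c × StrictlyBetween u m p
  shielding-endpoint c p m wf full p∉c page-p 2≤m m≤k m∈c = shield (<-cmp m p)
    where
    Shield : Set
    Shield = Σ ℕ λ u → u ∈ᵇ c × StrictlyBetween u m p
    cachedEndpoint : ∀ u → Page u → StrictlyBetween u m p → Shield
    cachedEndpoint u page-u btw =
      u , full-cache-holds-others c p u wf full p∉c page-p page-u (StrictlyBetween⇒≢ u m p btw) , btw
    shield : Tri (m < p) (m ≡ p) (p < m) → Shield
    shield (tri< m<p _ _) = cachedEndpoint 1 (≤-refl , s≤s z≤n) (inj₁ (2≤m , m<p))
    shield (tri≈ _ m≡p _) = ⊥-elim (∉ᵇ⇒¬∈ᵇ p c p∉c (subst (_∈ᵇ c) m≡p m∈c))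
    shield (tri> _ _ p<m) = cachedEndpoint (suc k) (s≤s z≤n , ≤-refl) (inj₂ (p<m , s≤s m≤k))

  pendingMiddle : List ℕ → List ℕ → ℕ → ℕ
  pendingMiddle c s m = if member m c then 0 else (if member m s then 1 else 0)

  missingMiddle : List ℕ → List ℕ → ℕ
  missingMiddle c s = sum (map (pendingMiddle c s) (down k))

  endpointRequests : List ℕ → ℕ
  endpointRequests s = occurrences 1 s + occurrences (suc k) s

  potential : List ℕ → List ℕ → ℕ
  potential c s = missingMiddle c s + endpointRequests s

  pendingMiddle-≤1 : ∀ c s m → pendingMiddle c s m ≤ 1
  pendingMiddle-≤1 c s m with member m c | member m s
  ... | true  | _     = z≤n
  ... | false | true  = ≤-refl
  ... | false | false = z≤n

  pendingMiddle-mono : ∀ c c′ s s′ m → (m ∈ᵇ c → m ∈ᵇ c′ ⊎ m ∉ᵇ s′) → (m ∈ᵇ s′ → m ∈ᵇ s) →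
                       pendingMiddle c′ s′ m ≤ pendingMiddle c s m
  pendingMiddle-mono c c′ s s′ m kept shrunk with member m c | member m c′ | member m s | member m s′
  ... | _     | true  | _     | _     = z≤n
  ... | _     | false | _     | false = z≤n
  ... | false | false | true  | true  = ≤-refl
  ... | false | false | false | true  with shrunk refl
  ...   | ()
  pendingMiddle-mono c c′ s s′ m kept shrunk | true | false | _ | true with kept refl
  ...   | inj₁ ()
  ...   | inj₂ ()

  length-down : ∀ j → length (down j) ≡ j ∸ 1
  length-down zero          = refl
  length-down (suc zero)    = refl
  length-down (suc (suc j)) = cong suc (length-down (suc j))

  missingMiddle-≤ : ∀ c s → missingMiddle c s ≤ k ∸ 1
  missingMiddle-≤ c s = subst (missingMiddle c s ≤_) (length-down k)
                          (sum-map-≤-length (pendingMiddle c s) (down k) (pendingMiddle-≤1 c s))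

  down-bounds : ∀ j m → m ∈ᵇ down j → 2 ≤ m × m ≤ j
  down-bounds (suc (suc j)) m m∈ =
    [ (λ { refl → s≤s (s≤s z≤n) , ≤-refl })
    , (λ m∈′ → map₂ m≤n⇒m≤1+n (down-bounds (suc j) m m∈′))
    ]′ (∈ᵇ-∷⁻ m (suc (suc j)) (down (suc j)) m∈)

  ∈ᵇ-down : ∀ j m → 2 ≤ m → m ≤ j → m ∈ᵇ down j
  ∈ᵇ-down zero          m (s≤s (s≤s _)) ()
  ∈ᵇ-down (suc zero)    m (s≤s (s≤s _)) (s≤s ())
  ∈ᵇ-down (suc (suc j)) m 2≤m m≤j = atTop (m ≟ suc (suc j)) (∈ᵇ-down (suc j) m 2≤m)
    where
    atTop : Dec (m ≡ suc (suc j)) → (m ≤ suc j → m ∈ᵇ down (suc j)) → m ∈ᵇ down (suc (suc j))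
    atTop (yes m≡j) _     = ∈ᵇ-≡ m (suc (suc j)) (down (suc j)) m≡j
    atTop (no m≢j)  below = ∈ᵇ-there m (suc (suc j)) (down (suc j)) (below (≤-pred (≤∧≢⇒< m≤j m≢j)))

  Endpoint : ℕ → Set
  Endpoint p = p ≡ 1 ⊎ p ≡ suc k

  page-kind : ∀ p → Page p → Endpoint p ⊎ (2 ≤ p × p ≤ k)
  page-kind p (1≤p , p≤k+1) with p ≟ 1 | p ≟ suc k
  ... | yes p≡1 | _         = inj₁ (inj₁ p≡1)
  ... | no _    | yes p≡k+1 = inj₁ (inj₂ p≡k+1)
  ... | no p≢1  | no p≢k+1  = inj₂ (≤∧≢⇒< 1≤p (λ 1≡p → p≢1 (sym 1≡p)) , ≤-pred (≤∧≢⇒< p≤k+1 p≢k+1))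

  endpointRequests-∷ : ∀ p s → endpointRequests s ≤ endpointRequests (p ∷ s)
  endpointRequests-∷ p s = +-mono-≤ (occurrences-∷ 1 p s) (occurrences-∷ (suc k) p s)

  endpointRequests-endpoint : ∀ p s → Endpoint p → endpointRequests s < endpointRequests (p ∷ s)
  endpointRequests-endpoint .1 s (inj₁ refl) = +-monoʳ-≤ (suc (occurrences 1 s)) (occurrences-∷ (suc k) 1 s)
  endpointRequests-endpoint .(suc k) s (inj₂ refl) rewrite ≡ᵇ-refl (suc k) =
    subst (_≤ occurrences 1 (suc k ∷ s) + suc (occurrences (suc k) s)) (+-suc (occurrences 1 s) (occurrences (suc k) s))
      (+-monoˡ-≤ (suc (occurrences (suc k) s)) (occurrences-∷ 1 (suc k) s))

  potential-hit : ∀ c c′ p s → c ⊆ᵇ c′ → potential c′ s ≤ potential c (p ∷ s)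
  potential-hit c c′ p s c⊆c′ = +-mono-≤
    (sum-map-mono (pendingMiddle c′ s) (pendingMiddle c (p ∷ s)) (down k)
      (λ m _ → pendingMiddle-mono c c′ (p ∷ s) s m (λ m∈ → inj₁ (c⊆c′ m m∈)) (∈ᵇ-there m p s)))
    (endpointRequests-∷ p s)

  -- A fault that brings p into the cache and evicts no middle page that is
  -- requested again strictly decreases the potential: a middle p stops being
  -- pending, an endpoint p uses up one endpoint request.
  potential-fault : ∀ c c′ p s → Page p → p ∉ᵇ c → p ∈ᵇ c′ →
                    (∀ m → 2 ≤ m → m ≤ k → m ∈ᵇ c → m ∈ᵇ c′ ⊎ m ∉ᵇ s) →
                    potential c′ s < potential c (p ∷ s)
  potential-fault c c′ p s page-p p∉c p∈c′ middle-kept = byKind (page-kind p page-p)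
    where
    pointwise : ∀ m → m ∈ᵇ down k → pendingMiddle c′ s m ≤ pendingMiddle c (p ∷ s) m
    pointwise m m∈ = pendingMiddle-mono c c′ (p ∷ s) s m
                       (middle-kept m (proj₁ (down-bounds k m m∈)) (proj₂ (down-bounds k m m∈)))
                       (∈ᵇ-there m p s)
    p-resolved : pendingMiddle c′ s p < pendingMiddle c (p ∷ s) p
    p-resolved rewrite p∈c′ | p∉c | ∈ᵇ-here p s = s≤s z≤n
    byKind : Endpoint p ⊎ (2 ≤ p × p ≤ k) → potential c′ s < potential c (p ∷ s)
    byKind (inj₁ endpoint) =
      subst (_≤ potential c (p ∷ s)) (+-suc (missingMiddle c′ s) (endpointRequests s))
        (+-mono-≤ (sum-map-mono _ _ (down k) pointwise) (endpointRequests-endpoint p s endpoint))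
    byKind (inj₂ (2≤p , p≤k)) =
      +-mono-≤ (sum-map-strict _ _ (down k) p pointwise (∈ᵇ-down k p 2≤p p≤k) p-resolved)
               (endpointRequests-∷ p s)

  Requests : List ℕ → Set
  Requests ps = ∀ x → x ∈ᵇ ps → Page x

  Requests-tail : ∀ p ps → Requests (p ∷ ps) → Requests ps
  Requests-tail p ps pages-ps x x∈ = pages-ps x (∈ᵇ-there x p ps x∈)

  WellFormed-∷ : ∀ c p c′ → WellFormed c → p ∉ᵇ c′ → c′ ⊆ᵇ c → Distinct c′ → Page p → WellFormed (p ∷ c′)
  WellFormed-∷ c p c′ (_ , c-pages) p∉c′ c′⊆c dc′ page-p =
    (p∉c′ , dc′) , λ x x∈ → [ (λ { refl → page-p }) , (λ x∈c′ → c-pages x (c′⊆c x x∈c′)) ]′ (∈ᵇ-∷⁻ x p c′ x∈)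

  -- LRU.  The history h lists the past requests, most recent first; LRU keeps
  -- its cache sorted by recency, the position in h of a page's last request.
  recency : List ℕ → ℕ → ℕ
  recency h x = dist x h

  LRUInvariant : List ℕ → List ℕ → Set
  LRUInvariant h c = Walk h × WellFormed c × Sorted (recency h) c × c ⊆ᵇ h

  Follows : List ℕ → List ℕ → Set
  Follows (q ∷ _) (p ∷ _) = Near p q
  Follows _       _       = ⊤

  walk-extend : ∀ p h ps → Walk h → Follows h (p ∷ ps) → Walk (p ∷ h)
  walk-extend p []      ps _  _    = tt
  walk-extend p (q ∷ h) ps wk near = near , wk

  follows-step : ∀ p h ps → Walk (p ∷ ps) → Follows (p ∷ h) ps
  follows-step p h []       _                 = tt
  follows-step p h (q ∷ ps) ((p≤q+1 , q≤p+1) , _) = q≤p+1 , p≤q+1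

  LRUInvariant-step : ∀ h c p ps c′ → LRUInvariant h c → Follows h (p ∷ ps) → p ∉ᵇ c′ → c′ ⊆ᵇ c →
                      Distinct c′ → Sorted (recency h) c′ → Page p → LRUInvariant (p ∷ h) (p ∷ c′)
  LRUInvariant-step h c p ps c′ (wk , wf , _ , c⊆h) follows p∉c′ c′⊆c dc′ sorted page-p =
    walk-extend p h ps wk follows ,
    WellFormed-∷ c p c′ wf p∉c′ c′⊆c dc′ page-p ,
    (p-first , Sorted-shift (recency h) (recency (p ∷ h)) c′ (λ x x∈ → older x (x≢p x x∈)) sorted) ,
    ∷-⊆ᵇ p c′ h (λ x x∈ → c⊆h x (c′⊆c x x∈))
    where
    x≢p : ∀ x → x ∈ᵇ c′ → x ≢ p
    x≢p x x∈ refl = ∉ᵇ⇒¬∈ᵇ x c′ p∉c′ x∈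
    older : ∀ x → x ≢ p → recency (p ∷ h) x ≡ suc (recency h x)
    older x x≢p rewrite ≡ᵇ-false x≢p = refl
    p-first : ∀ y → y ∈ᵇ c′ → recency (p ∷ h) p < recency (p ∷ h) y
    p-first y y∈ rewrite ≡ᵇ-refl p | older y (x≢p y y∈) = s≤s z≤n

  -- LRU evicts no middle page: the page evicted from a full cache is the
  -- least recent one, but a cached middle page m was requested after the
  -- shielding endpoint u, since the walk from u to p passed through m.
  lru-keeps-middle : ∀ h c p ps m → LRUInvariant h c → Follows h (p ∷ ps) → p ∉ᵇ c → Page p →
                     k ≤ length c → 2 ≤ m → m ≤ k → m ∈ᵇ c → m ∈ᵇ dropLast c
  lru-keeps-middle [] c p ps m (_ , _ , _ , c⊆h) _ _ _ _ _ _ m∈c = ⊥-elim (∉ᵇ⇒¬∈ᵇ m [] refl (c⊆h m m∈c))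
  lru-keeps-middle (q ∷ w) c p ps m (wk , wf , sorted , c⊆h) near p∉c page-p full 2≤m m≤k m∈c
    with ∈ᵇ-dec m (dropLast c) | shielding-endpoint c p m wf full p∉c page-p 2≤m m≤k m∈c
  ... | inj₁ m∈ | _ = m∈
  ... | inj₂ m∉ | u , u∈c , btw =
    ⊥-elim (<⇒≱ (walk-visits-between-first q w u m wk (c⊆h m m∈c) (StrictlyBetween⇒Between u m p q near btw))
                (dropLast-max (recency (q ∷ w)) c m sorted m∈c m∉ u u∈c))

  -- Every hit
  -- and every fault is a step of `potential-hit` / `potential-fault`; the
  -- latter applies since LRU keeps all middle pages (`lru-keeps-middle`).
  lru-≤-potential : ∀ ps h c → LRUInvariant h c → Follows h ps → Walk ps → Requests ps →
                    lruRun k c ps ≤ potential c ps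
  lru-≤-potential []       h c _ _ _ _ = z≤n
  lru-≤-potential (p ∷ ps) h c inv@(_ , (dc , _) , sorted , _) follows wk requests = serve (∈ᵇ-dec p c)
    where
    page-p : Page p
    page-p = requests p (∈ᵇ-here p ps)
    rest : ∀ c′ → p ∉ᵇ c′ → c′ ⊆ᵇ c → Distinct c′ → Sorted (recency h) c′ →
           lruRun k (p ∷ c′) ps ≤ potential (p ∷ c′) ps
    rest c′ p∉c′ c′⊆c dc′ sorted′ =
      lru-≤-potential ps (p ∷ h) (p ∷ c′) (LRUInvariant-step h c p ps c′ inv follows p∉c′ c′⊆c dc′ sorted′ page-p)
        (follows-step p h ps wk) (walk-tail p ps wk) (Requests-tail p ps requests)
    serve : p ∈ᵇ c ⊎ p ∉ᵇ c → lruRun k c (p ∷ ps) ≤ potential c (p ∷ ps)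
    serve (inj₁ hit) rewrite hit =
      ≤-trans (rest (remove p c) (∉ᵇ-remove p c) (remove-⊆ᵇ p c) (Distinct-remove p c dc) (Sorted-remove (recency h) p c sorted))
              (potential-hit c (p ∷ remove p c) p ps (⊆ᵇ-to-front p c))
    serve (inj₂ miss) rewrite miss with length c <ᵇ k in free?
    ... | true  = ≤-trans (s≤s (rest c miss (λ x x∈ → x∈) dc sorted))
                          (potential-fault c (p ∷ c) p ps page-p miss (∈ᵇ-here p c) (λ m _ _ m∈ → inj₁ (∈ᵇ-there m p c m∈)))
    ... | false = ≤-trans (s≤s (rest (dropLast c) (∉ᵇ-⊆ p c (dropLast c) (dropLast-⊆ᵇ c) miss) (dropLast-⊆ᵇ c)
                                     (Distinct-dropLast c dc) (Sorted-dropLast (recency h) c sorted)))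
                          (potential-fault c (p ∷ dropLast c) p ps page-p miss (∈ᵇ-here p (dropLast c)) kept)
      where
      kept : ∀ m → 2 ≤ m → m ≤ k → m ∈ᵇ c → m ∈ᵇ p ∷ dropLast c ⊎ m ∉ᵇ ps
      kept m 2≤m m≤k m∈c = inj₁ (∈ᵇ-there m p (dropLast c)
                             (lru-keeps-middle h c p ps m inv follows miss page-p (<ᵇ-false free?) 2≤m m≤k m∈c))

  -- LFD evicts no middle page that is requested again: its victim is the
  -- cached page requested latest, but a cached middle page m is requested
  -- before the shielding endpoint u, since the walk from p to u passes m.
  lfd-keeps-middle : ∀ c p ps m → WellFormed c → Walk (p ∷ ps) → p ∉ᵇ c → Page p → k ≤ length c →
                     2 ≤ m → m ≤ k → m ∈ᵇ c → m ∈ᵇ remove (victim ps c) c ⊎ m ∉ᵇ ps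
  lfd-keeps-middle c p ps m wf wk p∉c page-p full 2≤m m≤k m∈c with ∈ᵇ-dec m ps | m ≟ victim ps c
  ... | inj₂ m∉ps | _        = inj₂ m∉ps
  ... | inj₁ _    | no m≢v   = inj₁ (trans (member-remove m (victim ps c) c m≢v) m∈c)
  ... | inj₁ m∈ps | yes refl with shielding-endpoint c p m wf full p∉c page-p 2≤m m≤k m∈c
  ...   | u , u∈c , btw = ⊥-elim (<⇒≱ m-sooner (victim-max ps c u u∈c))
    where
    m≢p : m ≢ p
    m≢p refl = ∉ᵇ⇒¬∈ᵇ m c p∉c m∈c
    m-sooner : dist m ps < dist u ps
    m-sooner with walk-visits-between-first p ps u m wk (∈ᵇ-there m p ps m∈ps)
                    (StrictlyBetween⇒Between u m p p (n≤1+n p , n≤1+n p) btw)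
    ... | lt rewrite ≡ᵇ-false m≢p | ≡ᵇ-false (StrictlyBetween⇒≢ u m p btw) = ≤-pred lt

  lfd-≤-potential : ∀ ps c → WellFormed c → Walk ps → Requests ps → lfdRun k c ps ≤ potential c ps
  lfd-≤-potential []       c _ _ _ = z≤n
  lfd-≤-potential (p ∷ ps) c wf@(dc , _) wk requests = serve (∈ᵇ-dec p c)
    where
    page-p : Page p
    page-p = requests p (∈ᵇ-here p ps)
    rest : ∀ c′ → WellFormed c′ → lfdRun k c′ ps ≤ potential c′ ps
    rest c′ wf′ = lfd-≤-potential ps c′ wf′ (walk-tail p ps wk) (Requests-tail p ps requests)
    serve : p ∈ᵇ c ⊎ p ∉ᵇ c → lfdRun k c (p ∷ ps) ≤ potential c (p ∷ ps)
    serve (inj₁ hit) rewrite hit = ≤-trans (rest c wf) (potential-hit c c p ps (λ x x∈ → x∈))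
    serve (inj₂ miss) rewrite miss with length c <ᵇ k in free?
    ... | true  = ≤-trans (s≤s (rest (p ∷ c) (WellFormed-∷ c p c wf miss (λ x x∈ → x∈) dc page-p)))
                          (potential-fault c (p ∷ c) p ps page-p miss (∈ᵇ-here p c) (λ m _ _ m∈ → inj₁ (∈ᵇ-there m p c m∈)))
    ... | false = ≤-trans (s≤s (rest (p ∷ c′) (WellFormed-∷ c p c′ wf (∉ᵇ-⊆ p c c′ (remove-⊆ᵇ v c) miss) (remove-⊆ᵇ v c)
                                                 (Distinct-remove v c dc) page-p)))
                          (potential-fault c (p ∷ c′) p ps page-p miss (∈ᵇ-here p c′) kept)
      where
      v : ℕ
      v = victim ps c
      c′ : List ℕ
      c′ = remove v c
      kept : ∀ m → 2 ≤ m → m ≤ k → m ∈ᵇ c → m ∈ᵇ p ∷ c′ ⊎ m ∉ᵇ ps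
      kept m 2≤m m≤k m∈c = map₁ (∈ᵇ-there m p c′)
                             (lfd-keeps-middle c p ps m wf wk miss page-p (<ᵇ-false free?) 2≤m m≤k m∈c)

-- Lower bounds hold for every demand-paging algorithm, given by its run
-- function `run cache requests` (the number of faults): a hit loses no
-- cached page, a fault brings in the requested page and otherwise only
-- evicts, and caches never exceed size k.
record DemandPaging (k : ℕ) (run : List ℕ → List ℕ → ℕ) : Set where
  field
    hit   : ∀ c p ps → length c ≤ k → p ∈ᵇ c →
            Σ (List ℕ) λ c′ → length c′ ≤ k × c ⊆ᵇ c′ × run c (p ∷ ps) ≡ run c′ ps
    fault : ∀ c p ps → length c ≤ k → p ∉ᵇ c →
            Σ (List ℕ) λ c′ → length c′ ≤ k × p ∈ᵇ c′ × c′ ⊆ᵇ p ∷ c × run c (p ∷ ps) ≡ suc (run c′ ps)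

asc : ℕ → ℕ → List ℕ
asc a zero    = []
asc a (suc m) = a ∷ asc (suc a) m

∈ᵇ-asc : ∀ a m y → a ≤ y → y < a + m → y ∈ᵇ asc a m
∈ᵇ-asc a zero    y a≤y y<a+0 = ⊥-elim (<-irrefl refl (<-≤-trans y<a+0 (subst (_≤ y) (sym (+-identityʳ a)) a≤y)))
∈ᵇ-asc a (suc m) y a≤y y<a+m with y ≟ a
... | yes y≡a = ∈ᵇ-≡ y a (asc (suc a) m) y≡a
... | no y≢a  = ∈ᵇ-there y a (asc (suc a) m)
                  (∈ᵇ-asc (suc a) m y (≤∧≢⇒< a≤y (λ a≡y → y≢a (sym a≡y))) (subst (y <_) (+-suc a m) y<a+m))

asc-bounds : ∀ a m y → y ∈ᵇ asc a m → a ≤ y × y < a + m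
asc-bounds a (suc m) y y∈ with ∈ᵇ-∷⁻ y a (asc (suc a) m) y∈
... | inj₁ refl = ≤-refl , subst (a <_) (sym (+-suc a m)) (s≤s (m≤m+n a m))
... | inj₂ y∈′  with asc-bounds (suc a) m y y∈′
...   | a<y , y<a+m = <⇒≤ a<y , subst (y <_) (sym (+-suc a m)) y<a+m

module LowerBound {k : ℕ} {run : List ℕ → List ℕ → ℕ} (alg : DemandPaging k run) where

  open DemandPaging alg
  open Paging k using (Page; no-cache-holds-all-pages)

  -- `After n t ps r`: the algorithm can be in a cache holding t, before the
  -- requests ps, having made n faults beyond those counted in r.
  After : ℕ → ℕ → List ℕ → ℕ → Set
  After n t ps r = Σ (List ℕ) λ c′ → length c′ ≤ k × t ∈ᵇ c′ × n + run c′ ps ≤ r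

  After-mono : ∀ {n t ps r r′} → r ≤ r′ → After n t ps r → After n t ps r′
  After-mono r≤r′ (c′ , size , t∈ , bound) = c′ , size , t∈ , ≤-trans bound r≤r′

  After-fault : ∀ {n t ps r r′} → suc r ≤ r′ → After n t ps r → After (suc n) t ps r′
  After-fault r<r′ (c′ , size , t∈ , bound) = c′ , size , t∈ , ≤-trans (s≤s bound) r<r′

  serve-one : ∀ c p ps → length c ≤ k → After 0 p ps (run c (p ∷ ps))
  serve-one c p ps size with ∈ᵇ-dec p c
  ... | inj₁ p∈ with hit c p ps size p∈
  ...   | c′ , size′ , c⊆c′ , eq = c′ , size′ , c⊆c′ p p∈ , ≤-reflexive (sym eq)
  serve-one c p ps size | inj₂ p∉ with fault c p ps size p∉
  ...   | c′ , size′ , p∈ , _ , eq = c′ , size′ , p∈ , subst (run c′ ps ≤_) (sym eq) (n≤1+n _)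

  serve-prefix : ∀ s t ps c → length c ≤ k → After 0 t ps (run c (s ++ t ∷ ps))
  serve-prefix []      t ps c size = serve-one c t ps size
  serve-prefix (p ∷ s) t ps c size with serve-one c p (s ++ t ∷ ps) size
  ... | c₁ , size₁ , _ , bound = After-mono bound (serve-prefix s t ps c₁ size₁)

  -- If the cache together with the window s ++ t covers all k+1 pages, the
  -- window causes a fault: before the first fault every page of the window
  -- is cached, which no cache of size k can do.
  Covers : List ℕ → List ℕ → Set
  Covers c w = ∀ y → Page y → y ∈ᵇ c ⊎ y ∈ᵇ w

  window-fault : ∀ s t ps c → length c ≤ k → Covers c (s ++ t ∷ []) → After 1 t ps (run c (s ++ t ∷ ps))
  window-fault [] t ps c size covers with ∈ᵇ-dec t c
  ... | inj₁ t∈ = ⊥-elim (no-cache-holds-all-pages c size λ y page-y →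
                    [ (λ y∈c → y∈c) , (λ y∈t → [ (λ { refl → t∈ }) , (λ ()) ]′ (∈ᵇ-∷⁻ y t [] y∈t)) ]′ (covers y page-y))
  ... | inj₂ t∉ with fault c t ps size t∉
  ...   | c′ , size′ , t∈ , _ , eq = c′ , size′ , t∈ , ≤-reflexive (sym eq)
  window-fault (p ∷ s) t ps c size covers with ∈ᵇ-dec p c
  ... | inj₁ p∈ with hit c p (s ++ t ∷ ps) size p∈
  ...   | c₁ , size₁ , c⊆c₁ , eq = After-mono (≤-reflexive (sym eq)) (window-fault s t ps c₁ size₁ covers₁)
    where
    covers₁ : Covers c₁ (s ++ t ∷ [])
    covers₁ y page-y with covers y page-y
    ... | inj₁ y∈c = inj₁ (c⊆c₁ y y∈c)
    ... | inj₂ y∈w = [ (λ { refl → inj₁ (c⊆c₁ y p∈) }) , inj₂ ]′ (∈ᵇ-∷⁻ y p (s ++ t ∷ []) y∈w)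
  window-fault (p ∷ s) t ps c size covers | inj₂ p∉ with fault c p (s ++ t ∷ ps) size p∉
  ...   | c₁ , size₁ , _ , _ , eq = After-fault (≤-reflexive (sym eq)) (serve-prefix s t ps c₁ size₁)

  cold-start : ∀ m a c ps → length c ≤ k → (∀ x → x ∈ᵇ c → x < a) → After (suc m) (a + m) ps (run c (asc a (suc m) ++ ps))
  cold-start m a c ps size below with ∈ᵇ-dec a c
  ... | inj₁ a∈ = ⊥-elim (<-irrefl refl (below a a∈))
  ... | inj₂ a∉ = after-first m (fault c a (asc (suc a) m ++ ps) size a∉)
    where
    after-first : ∀ m → (Σ (List ℕ) λ c₁ → length c₁ ≤ k × a ∈ᵇ c₁ × c₁ ⊆ᵇ a ∷ c ×
                                           run c (asc a (suc m) ++ ps) ≡ suc (run c₁ (asc (suc a) m ++ ps))) →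
                  After (suc m) (a + m) ps (run c (asc a (suc m) ++ ps))
    after-first zero (c₁ , size₁ , a∈ , _ , eq) =
      c₁ , size₁ , subst (_∈ᵇ c₁) (sym (+-identityʳ a)) a∈ , ≤-reflexive (sym eq)
    after-first (suc m′) (c₁ , size₁ , _ , c₁⊆ , eq) =
      subst (λ t → After (suc (suc m′)) t ps (run c (asc a (suc (suc m′)) ++ ps))) (sym (+-suc a m′))
        (After-fault (≤-reflexive (sym eq)) (cold-start m′ (suc a) c₁ ps size₁ below₁))
      where
      below₁ : ∀ x → x ∈ᵇ c₁ → x < suc a
      below₁ x x∈ = [ (λ { refl → ≤-refl }) , (λ x∈c → m<n⇒m<1+n (below x x∈c)) ]′ (∈ᵇ-∷⁻ x a c (c₁⊆ x x∈))

module Instance (k₀ : ℕ) where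

  k : ℕ
  k = suc k₀

  lru-demand : DemandPaging k (lruRun k)
  DemandPaging.hit lru-demand c p ps size p∈ rewrite p∈ =
    p ∷ remove p c , ≤-trans (length-remove-< p c p∈) size , ⊆ᵇ-to-front p c , refl
  DemandPaging.fault lru-demand [] p ps size p∉ = p ∷ [] , s≤s z≤n , ∈ᵇ-here p [] , (λ x x∈ → x∈) , refl
  DemandPaging.fault lru-demand (a ∷ cs) p ps size p∉ rewrite p∉ with length (a ∷ cs) <ᵇ k in free?
  ... | true  = p ∷ a ∷ cs , <ᵇ-true free? , ∈ᵇ-here p (a ∷ cs) , (λ x x∈ → x∈) , refl
  ... | false = p ∷ dropLast (a ∷ cs) , subst (_≤ k) (sym (length-dropLast a cs)) size ,
                ∈ᵇ-here p (dropLast (a ∷ cs)) , ∷-⊆ᵇ p (dropLast (a ∷ cs)) (a ∷ cs) (dropLast-⊆ᵇ (a ∷ cs)) , refl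

  lfd-demand : DemandPaging k (lfdRun k)
  DemandPaging.hit lfd-demand c p ps size p∈ rewrite p∈ = c , size , (λ x x∈ → x∈) , refl
  DemandPaging.fault lfd-demand [] p ps size p∉ = p ∷ [] , s≤s z≤n , ∈ᵇ-here p [] , (λ x x∈ → x∈) , refl
  DemandPaging.fault lfd-demand (a ∷ cs) p ps size p∉ rewrite p∉ with length (a ∷ cs) <ᵇ k in free?
  ... | true  = p ∷ a ∷ cs , <ᵇ-true free? , ∈ᵇ-here p (a ∷ cs) , (λ x x∈ → x∈) , refl
  ... | false = p ∷ remove v (a ∷ cs) , ≤-trans (length-remove-< v (a ∷ cs) (victim-∈ᵇ ps a cs)) size ,
                ∈ᵇ-here p (remove v (a ∷ cs)) , ∷-⊆ᵇ p (remove v (a ∷ cs)) (a ∷ cs) (remove-⊆ᵇ v (a ∷ cs)) , refl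
    where
    v : ℕ
    v = victim ps (a ∷ cs)

  applyUpTo-asc : ∀ m (f : ℕ → ℕ) a → (∀ i → f i ≡ a + i) → applyUpTo f m ≡ asc a m
  applyUpTo-asc zero    f a f≡ = refl
  applyUpTo-asc (suc m) f a f≡ = cong₂ _∷_ (trans (f≡ 0) (+-identityʳ a))
    (applyUpTo-asc m (λ i → f (suc i)) (suc a) (λ i → trans (f≡ (suc i)) (+-suc a i)))

  Iseq-suc : ∀ n → Iseq k (suc n) ≡ asc 1 (suc k) ++ down k ++ Iseq k n
  Iseq-suc n = begin
    (map suc (upTo (suc k)) ++ down k) ++ Iseq k n  ≡⟨ cong (λ xs → (xs ++ down k) ++ Iseq k n) ascent ⟩
    (asc 1 (suc k) ++ down k) ++ Iseq k n           ≡⟨ ++-assoc (asc 1 (suc k)) (down k) (Iseq k n) ⟩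
    asc 1 (suc k) ++ down k ++ Iseq k n             ∎
    where
    open ≡-Reasoning
    ascent : map suc (upTo (suc k)) ≡ asc 1 (suc k)
    ascent = trans (map-applyUpTo (λ x → x) suc (suc k)) (applyUpTo-asc (suc k) suc 1 (λ i → refl))

  asc-snoc : ∀ a m → asc a (suc m) ≡ asc a m ++ (a + m) ∷ []
  asc-snoc a zero    = cong (_∷ []) (sym (+-identityʳ a))
  asc-snoc a (suc m) = cong (a ∷_) (trans (asc-snoc (suc a) m) (cong (λ t → asc (suc a) m ++ t ∷ []) (sym (+-suc a m))))

  later-block-windows : ∀ n → down k ++ Iseq k (suc n) ≡ down k ++ 1 ∷ (asc 2 k₀ ++ suc k ∷ (down k ++ Iseq k n))
  later-block-windows n = cong (down k ++_) (begin
    Iseq k (suc n)                                          ≡⟨ Iseq-suc n ⟩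
    1 ∷ asc 2 k ++ down k ++ Iseq k n                       ≡⟨ cong (λ xs → 1 ∷ xs ++ down k ++ Iseq k n) (asc-snoc 2 k₀) ⟩
    1 ∷ (asc 2 k₀ ++ suc k ∷ []) ++ down k ++ Iseq k n      ≡⟨ cong (1 ∷_) (++-assoc (asc 2 k₀) (suc k ∷ []) (down k ++ Iseq k n)) ⟩
    1 ∷ asc 2 k₀ ++ suc k ∷ down k ++ Iseq k n              ∎)
    where open ≡-Reasoning

  -- Each later block forces two faults: descending to 1 while k+1 is cached,
  -- and ascending to k+1 while 1 is cached, both windows cover all pages.
  module _ {run : List ℕ → List ℕ → ℕ} (alg : DemandPaging k run) where

    open LowerBound alg
    open Paging k using (page-kind; ∈ᵇ-down)

    descent-covers : ∀ c → suc k ∈ᵇ c → Covers c (down k ++ 1 ∷ [])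
    descent-covers c top∈ y page-y with page-kind y page-y
    ... | inj₁ (inj₁ refl)    = inj₂ (∈ᵇ-++⁺ʳ 1 (down k) (1 ∷ []) (∈ᵇ-here 1 []))
    ... | inj₁ (inj₂ refl)    = inj₁ top∈
    ... | inj₂ (2≤y , y≤k)    = inj₂ (∈ᵇ-++⁺ˡ y (down k) (1 ∷ []) (∈ᵇ-down k y 2≤y y≤k))

    ascent-covers : ∀ c → 1 ∈ᵇ c → Covers c (asc 2 k₀ ++ suc k ∷ [])
    ascent-covers c bottom∈ y page-y with page-kind y page-y
    ... | inj₁ (inj₁ refl)    = inj₁ bottom∈
    ... | inj₁ (inj₂ refl)    = inj₂ (∈ᵇ-++⁺ʳ (suc k) (asc 2 k₀) (suc k ∷ []) (∈ᵇ-here (suc k) []))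
    ... | inj₂ (2≤y , y≤k)    = inj₂ (∈ᵇ-++⁺ˡ y (asc 2 k₀) (suc k ∷ []) (∈ᵇ-asc 2 k₀ y 2≤y (s≤s y≤k)))

    later-blocks : ∀ n c → length c ≤ k → suc k ∈ᵇ c → 2 * n ≤ run c (down k ++ Iseq k n)
    later-blocks zero    c size top∈ = z≤n
    later-blocks (suc n) c size top∈
      with window-fault (down k) 1 (asc 2 k₀ ++ suc k ∷ (down k ++ Iseq k n)) c size (descent-covers c top∈)
    ... | c₁ , size₁ , bottom∈ , descent
      with window-fault (asc 2 k₀) (suc k) (down k ++ Iseq k n) c₁ size₁ (ascent-covers c₁ bottom∈)
    ...   | c₂ , size₂ , top∈₂ , ascent = subst (_≤ run c (down k ++ Iseq k (suc n))) (sym (*-suc 2 n))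
      (subst (λ rs → suc (suc (2 * n)) ≤ run c rs) (sym (later-block-windows n))
        (≤-trans (s≤s (≤-trans (s≤s (later-blocks n c₂ size₂ top∈₂)) ascent)) descent))

    -- The first block costs k+1 cold faults and leaves k+1 cached.
    lower-bound : ∀ n → suc k + 2 * n ≤ run [] (Iseq k (suc n))
    lower-bound n with cold-start k 1 [] (down k ++ Iseq k n) z≤n (λ x ())
    ... | c₁ , size₁ , top∈ , first =
      subst (λ rs → suc k + 2 * n ≤ run [] rs) (sym (Iseq-suc n))
        (≤-trans (+-monoʳ-≤ (suc k) (later-blocks n c₁ size₁ top∈)) first)

  open Paging k using (Page; Endpoint; Requests; down-bounds; potential; missingMiddle; missingMiddle-≤; endpointRequests)

  Iseq-pages : ∀ n → Requests (Iseq k n)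
  Iseq-pages (suc n) x x∈ with ∈ᵇ-++⁻ x (asc 1 (suc k)) (down k ++ Iseq k n) (subst (x ∈ᵇ_) (Iseq-suc n) x∈)
  ... | inj₁ x∈asc with asc-bounds 1 (suc k) x x∈asc
  ...   | 1≤x , x<k+2 = 1≤x , ≤-pred x<k+2
  Iseq-pages (suc n) x x∈ | inj₂ x∈rest with ∈ᵇ-++⁻ x (down k) (Iseq k n) x∈rest
  ...   | inj₁ x∈down = ≤-trans (s≤s z≤n) (proj₁ (down-bounds k x x∈down)) , m≤n⇒m≤1+n (proj₂ (down-bounds k x x∈down))
  ...   | inj₂ x∈Iseq = Iseq-pages n x x∈Iseq

  occurrences-asc : ∀ t a m → occurrences t (asc a m) ≤ 1
  occurrences-asc t a zero    = z≤n
  occurrences-asc t a (suc m) with a ≟ t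
  ... | yes refl rewrite ≡ᵇ-refl a | occurrences-absent a (asc (suc a) m) (λ y y∈ a≡y → <-irrefl (sym a≡y) (proj₁ (asc-bounds (suc a) m y y∈))) = ≤-refl
  ... | no a≢t rewrite ≡ᵇ-false a≢t = occurrences-asc t (suc a) m

  endpoint-occurrences : ∀ t → Endpoint t → ∀ n → occurrences t (Iseq k n) ≤ n
  endpoint-occurrences t endpoint zero    = z≤n
  endpoint-occurrences t endpoint (suc n) = begin
    occurrences t (Iseq k (suc n))                                      ≡⟨ cong (occurrences t) (Iseq-suc n) ⟩
    occurrences t (asc 1 (suc k) ++ down k ++ Iseq k n)                 ≡⟨ occurrences-++ t (asc 1 (suc k)) (down k ++ Iseq k n) ⟩
    occurrences t (asc 1 (suc k)) + occurrences t (down k ++ Iseq k n)  ≡⟨ cong (occurrences t (asc 1 (suc k)) +_) (occurrences-++ t (down k) (Iseq k n)) ⟩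
    occurrences t (asc 1 (suc k)) + (occurrences t (down k) + occurrences t (Iseq k n))
      ≡⟨ cong (λ d → occurrences t (asc 1 (suc k)) + (d + occurrences t (Iseq k n))) (occurrences-absent t (down k) middle≢t) ⟩
    occurrences t (asc 1 (suc k)) + occurrences t (Iseq k n)           ≤⟨ +-mono-≤ (occurrences-asc t 1 (suc k)) (endpoint-occurrences t endpoint n) ⟩
    suc n                                                               ∎
    where
    open ≤-Reasoning
    middle≢t : ∀ y → y ∈ᵇ down k → y ≢ t
    middle≢t y y∈ refl with down-bounds k y y∈
    ... | 2≤y , y≤k = [ (λ { refl → 1+n≰n 2≤y }) , (λ { refl → 1+n≰n y≤k }) ]′ endpoint

  -- Every rearrangement of I_{n+1} starts with potential at most 2n + k + 1:
  -- at most k-1 pending middle pages and n+1 requests to each endpoint.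
  initial-potential : ∀ n σ → σ ↭ Iseq k (suc n) → potential [] σ ≤ 2 * n + k + 1
  initial-potential n σ σ↭I = begin
    missingMiddle [] σ + endpointRequests σ  ≤⟨ +-mono-≤ (missingMiddle-≤ [] σ) (+-mono-≤ (endpoint 1 (inj₁ refl)) (endpoint (suc k) (inj₂ refl))) ⟩
    k₀ + (suc n + suc n)                     ≡⟨ arith k₀ n ⟩
    2 * n + k + 1                            ∎
    where
    open ≤-Reasoning
    arith : ∀ a n → a + (suc n + suc n) ≡ 2 * n + suc a + 1
    arith = solve-∀
    endpoint : ∀ t → Endpoint t → occurrences t σ ≤ suc n
    endpoint t endpoint-t = subst (_≤ suc n) (sym (occurrences-↭ t σ↭I)) (endpoint-occurrences t endpoint-t (suc n))

  module _ (N : ℕ) where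

    MayPrecede : ℕ → List ℕ → Set
    MayPrecede z []      = ⊤
    MayPrecede z (y ∷ _) = z ≡ y ⊎ PathEdge N z y

    Consecutive-∷ : ∀ z rest → MayPrecede z rest → Consecutive N rest → Consecutive N (z ∷ rest)
    Consecutive-∷ z []      _    _    = tt
    Consecutive-∷ z (y ∷ r) step cons = step , cons

    ascent-consecutive : ∀ m a rest → 1 ≤ a → a + m ≤ N → MayPrecede (a + m) rest → Consecutive N rest →
                         Consecutive N (asc a (suc m) ++ rest)
    ascent-consecutive zero    a rest 1≤a _ step cons =
      Consecutive-∷ a rest (subst (λ z → MayPrecede z rest) (+-identityʳ a) step) cons
    ascent-consecutive (suc m) a rest 1≤a a+m≤N step cons =
      Consecutive-∷ a (asc (suc a) (suc m) ++ rest) (inj₂ (inj₁ (1≤a , refl , ≤-trans (s≤s (m≤m+n a m)) a+m≤N′)))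
        (ascent-consecutive m (suc a) rest (s≤s z≤n) a+m≤N′ (subst (λ z → MayPrecede z rest) (+-suc a m) step) cons)
      where
      a+m≤N′ : suc a + m ≤ N
      a+m≤N′ = subst (_≤ N) (+-suc a m) a+m≤N

    descent-consecutive : ∀ j rest → j ≤ N → MayPrecede 2 rest → Consecutive N rest → Consecutive N (down j ++ rest)
    descent-consecutive zero                rest _   _    cons = cons
    descent-consecutive (suc zero)          rest _   _    cons = cons
    descent-consecutive (suc (suc zero))    rest _   step cons = Consecutive-∷ 2 rest step cons
    descent-consecutive (suc (suc (suc j))) rest j≤N step cons =
      Consecutive-∷ (suc (suc (suc j))) (down (suc (suc j)) ++ rest) (inj₂ (inj₂ (s≤s z≤n , refl , j≤N)))
        (descent-consecutive (suc (suc j)) rest (≤-trans (n≤1+n _) j≤N) step cons)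

    top-precedes-descent : ∀ j rest → suc j ≤ N → MayPrecede 2 rest → 1 ≤ j → MayPrecede (suc j) (down j ++ rest)
    top-precedes-descent (suc zero)    rest _   step _ = step
    top-precedes-descent (suc (suc j)) rest j≤N _    _ = inj₂ (inj₂ (s≤s z≤n , refl , j≤N))

    Iseq-consecutive : suc k ≤ N → ∀ n → Consecutive N (Iseq k n) × MayPrecede 2 (Iseq k n)
    Iseq-consecutive k<N zero    = tt , tt
    Iseq-consecutive k<N (suc n) with Iseq-consecutive k<N n
    ... | cons , step = subst (λ rs → Consecutive N rs × MayPrecede 2 rs) (sym (Iseq-suc n))
      ( ascent-consecutive k 1 (down k ++ Iseq k n) ≤-refl k<N
          (top-precedes-descent k (Iseq k n) k<N step (s≤s z≤n))
          (descent-consecutive k (Iseq k n) (≤-trans (n≤1+n k) k<N) step cons)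
      , inj₂ (inj₂ (≤-refl , refl , ≤-trans (s≤s (s≤s z≤n)) k<N)))

    consecutive⇒walk : ∀ σ → Consecutive N σ → Walk σ
    consecutive⇒walk []          _            = tt
    consecutive⇒walk (a ∷ [])    _            = tt
    consecutive⇒walk (a ∷ b ∷ σ) (step , cons) = near step , consecutive⇒walk (b ∷ σ) cons
      where
      near : a ≡ b ⊎ PathEdge N a b → Near a b
      near (inj₁ refl)                 = n≤1+n a , n≤1+n a
      near (inj₂ (inj₁ (_ , refl , _))) = ≤-trans (n≤1+n a) (n≤1+n (suc a)) , ≤-refl
      near (inj₂ (inj₂ (_ , refl , _))) = ≤-refl , ≤-trans (n≤1+n b) (n≤1+n (suc b))

  rearrangement-walk : ∀ N n σ → σ ↭ Iseq k (suc n) → RespectsPath N σ → Walk σ × Requests σ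
  rearrangement-walk N n σ σ↭I (_ , cons) =
    consecutive⇒walk N σ cons , λ x x∈σ → Iseq-pages (suc n) x (trans (sym (member-↭ x σ↭I)) x∈σ)

  lru-upper : ∀ N n σ → σ ↭ Iseq k (suc n) → RespectsPath N σ → LRU k σ ≤ 2 * n + k + 1
  lru-upper N n σ σ↭I respects with rearrangement-walk N n σ σ↭I respects
  ... | walk , requests = ≤-trans (Paging.lru-≤-potential k σ [] [] (tt , (tt , λ _ ()) , tt , λ _ ()) tt walk requests)
                                  (initial-potential n σ σ↭I)

  lfd-upper : ∀ N n σ → σ ↭ Iseq k (suc n) → RespectsPath N σ → LFD k σ ≤ 2 * n + k + 1
  lfd-upper N n σ σ↭I respects with rearrangement-walk N n σ σ↭I respects
  ... | walk , requests = ≤-trans (Paging.lfd-≤-potential k σ [] (tt , λ _ ()) walk requests)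
                                  (initial-potential n σ σ↭I)

  worst-case-at-I : ∀ (A : List ℕ → ℕ) N n → suc k ≤ N →
                    (∀ σ → σ ↭ Iseq k (suc n) → RespectsPath N σ → A σ ≤ 2 * n + k + 1) →
                    suc k + 2 * n ≤ A (Iseq k (suc n)) →
                    WorstIs A N (Iseq k (suc n)) (2 * n + k + 1)
  worst-case-at-I A N n k<N upper lower =
    (I , ↭.refl , respects , ≤-antisym (upper I ↭.refl respects) (subst (_≤ A I) (arith k₀ n) lower)) , upper
    where
    I : List ℕ
    I = Iseq k (suc n)
    arith : ∀ a n → suc (suc a) + 2 * n ≡ 2 * n + suc a + 1
    arith = solve-∀
    respects : RespectsPath N I
    respects = All-∈ᵇ I (λ x x∈ → map₂ (λ x≤k+1 → ≤-trans x≤k+1 k<N) (Iseq-pages (suc n) x x∈)) ,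
               proj₁ (Iseq-consecutive N k<N (suc n))

lemma7 : (k N n : ℕ) → 1 ≤ k → k + 1 ≤ N → 1 ≤ n →
    WorstIs (LRU k) N (Iseq k n) (2 * (n ∸ 1) + k + 1) ×
    WorstIs (LFD k) N (Iseq k n) (2 * (n ∸ 1) + k + 1)
lemma7 (suc k₀) N (suc n) (s≤s z≤n) k+1≤N (s≤s z≤n) =
  worst-case-at-I (LRU k) N n k<N (lru-upper N n) (lower-bound lru-demand n) ,
  worst-case-at-I (LFD k) N n k<N (lfd-upper N n) (lower-bound lfd-demand n)
  where
  open Instance k₀
  k<N : suc k ≤ N
  k<N = subst (_≤ N) (+-comm k 1) k+1≤N
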